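{- Let $\mathbf{L}$ be an intermediate logic, let $\mathbf{LJL}_0\in\{\mathbf{LJ}_0,\mathbf{LJT}_0,\mathbf{LJ4}_0,\mathbf{LJT4}_0\}$ and let $CS$ be a constant specification for $\mathbf{LJL}_0$. Let $\mathsf C$ be a class of Heyting algebras with respect to which $\mathbf L$ is strongly complete, and let $\mathsf{CAMJL}$ be the class of algebraic Mkrtychev models over algebras in $\mathsf C$ corresponding to $\mathbf{LJL}_0$ (all of them for $\mathbf{LJ}_0$; the factive ones for $\mathbf{LJT}_0$; the introspective ones for $\mathbf{LJ4}_0$; the factive and introspective ones for $\mathbf{LJT4}_0$), and $\mathsf{CAMJL}_{CS}$ its subclass of models respecting $CS$. For any $\Gamma\cup\{\phi\}\subseteq\mathcal L_J$ the following are equivalent: (1) $\Gamma\vdash_{\mathbf{LJL}_{CS}}\phi$; (2) $\Gamma\models_{\mathsf{CAMJL}_{CS}}\phi$; (3) $\Gamma\models^1_{\mathsf{CAMJL}_{CS}}\phi$.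
   Context: Intermediate logics: $\mathcal L_0$ is the propositional language over $Var=\{p_i\}$ with $\bot,\land,\lor,\to$; an intermediate logic is a set $\mathbf L\subsetneq\mathcal L_0$ containing all instances of the intuitionistic axiom schemes $\phi\to(\psi\to\phi)$; $(\phi\to(\chi\to\psi))\to((\phi\to\chi)\to(\phi\to\psi))$; $(\phi\land\psi)\to\phi$; $(\phi\land\psi)\to\psi$; $\phi\to(\psi\to(\phi\land\psi))$; $\phi\to(\phi\lor\psi)$; $\psi\to(\phi\lor\psi)$; $(\phi\to\psi)\to((\chi\to\psi)\to((\phi\lor\chi)\to\psi))$; $\bot\to\phi$, closed under modus ponens and substitution. $\Gamma\vdash_{\mathbf L}\phi$ iff $\bigwedge_{i\le n}\gamma_i\to\phi\in\mathbf L$ for some $\gamma_i\in\Gamma$ ($n\ge0$). $\mathbf L$ is strongly complete w.r.t. a class $\mathsf C$ of Heyting algebras iff for all $\Gamma\cup\{\phi\}\subseteq\mathcal L_0$: $\Gamma\vdash_{\mathbf L}\phi$ iff for every $\mathbf A\in\mathsf C$ and every map $f:\mathcal L_0\to A$ commuting with $\bot,\land,\lor,\to$ (sent to $0,\land^{\mathbf A},\lor^{\mathbf A},\to^{\mathbf A}$), $f[\Gamma]\subseteq\{1\}$ implies $f(\phi)=1$. Justification logics: terms $Jt$: $t::=x\mid c\mid[t+t]\mid[t\cdot t]\mid\,!t$ ($x\in V=\{x_i\}$, $c\in C=\{c_i\}$); $\mathcal L_J$: $\phi::=\bot\mid p\mid\phi\land\phi\mid\phi\lor\phi\mid\phi\to\phi\mid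 t:\phi$. $\overline{\mathbf L}$: all substitution instances $\sigma(\psi)$, $\psi\in\mathbf L$, $\sigma:Var\to\mathcal L_J$. Schemes $(J)$ $t:(\phi\to\psi)\to(s:\phi\to[t\cdot s]:\psi)$; $(+)$ $t:\phi\to[t+s]:\phi$, $t:\phi\to[s+t]:\phi$; $(F)$ $t:\phi\to\phi$; $(I)$ $t:\phi\to\,!t:t:\phi$. $\mathbf{LJ}_0$ = closure of $\overline{\mathbf L}\cup(J)\cup(+)$ under modus ponens; $\mathbf{LJT}_0$ adds $(F)$; $\mathbf{LJ4}_0$ adds $(I)$; $\mathbf{LJT4}_0$ adds both. A constant specification for $\mathbf{LJL}_0$ is a set of formulas $c_{i_n}:\dots:c_{i_1}:\phi$ ($n\ge1$) with $\phi\in\overline{\mathbf L}$ or $\phi$ an instance of a justification scheme of $\mathbf{LJL}_0$. $\Gamma\vdash_{\mathbf{LJL}_{CS}}\phi$ iff $\bigwedge_{i\le n}\gamma_i\to\phi\in\mathbf{LJL}_0$ for some $\gamma_i\in\Gamma\cup CS$ ($n\ge0$). An algebraic Mkrtychev model is $\mathfrak M=\langle\mathbf A,\mathcal V\rangle$ with $\mathbf A$ a Heyting algebra and $\mathcal V:\mathcal L_J\to A$ commuting with $\bot,\land,\lor,\to$ and satisfying $\mathcal V(t:(\phi\to\psi))\land\mathcal V(s:\phi)\le\mathcal V([t\cdot s]:\psi)$ and $\mathcal V(t:\phi)\lor\mathcal V(s:\phi)\le\mathcal V([t+s]:\phi)$ for all $t,s,\phi,\psi$. It is factive if $\mathcal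 V(t:\phi)\le\mathcal V(\phi)$ always, introspective if $\mathcal V(t:\phi)\le\mathcal V(!t:t:\phi)$ always; it respects $CS$ if $\mathcal V(\chi)=1$ for every $\chi\in CS$. For a class $\mathsf K$ of such models: $\Gamma\models_{\mathsf K}\phi$ iff in every model of $\mathsf K$, $\bigwedge\{\mathcal V(\gamma)\mid\gamma\in\Gamma\}\le\mathcal V(\phi)$ (the meet taken in $\mathbf A$, which is required to exist — e.g. for finite $\Gamma$); $\Gamma\models^1_{\mathsf K}\phi$ iff in every model of $\mathsf K$, $\mathcal V[\Gamma]\subseteq\{1\}$ implies $\mathcal V(\phi)=1$. -}

module Defs where

open import Level using (Level; _⊔_) renaming (suc to lsuc)
open import Data.Nat using (ℕ)
open import Data.List using (List; []; _∷_)
open import Data.List.Relation.Unary.All using (All)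
open import Data.Product using (Σ; ∃; _×_)
open import Data.Sum using (_⊎_)
open import Relation.Nullary using (¬_)
open import Relation.Binary.Lattice.Bundles using (HeytingAlgebra)

data Form₀ : Set where
  ⊥₀   : Form₀
  var₀ : ℕ → Form₀
  _∧₀_ : Form₀ → Form₀ → Form₀
  _∨₀_ : Form₀ → Form₀ → Form₀
  _⇒₀_ : Form₀ → Form₀ → Form₀

infixr 7 _∧₀_
infixr 6 _∨₀_
infixr 5 _⇒₀_

subst₀ : (ℕ → Form₀) → Form₀ → Form₀
subst₀ σ ⊥₀       = ⊥₀
subst₀ σ (var₀ i) = σ i
subst₀ σ (φ ∧₀ ψ) = subst₀ σ φ ∧₀ subst₀ σ ψ
subst₀ σ (φ ∨₀ ψ) = subst₀ σ φ ∨₀ subst₀ σ ψ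
subst₀ σ (φ ⇒₀ ψ) = subst₀ σ φ ⇒₀ subst₀ σ ψ

data IntAx₀ : Form₀ → Set where
  ax1 : ∀ φ ψ → IntAx₀ (φ ⇒₀ (ψ ⇒₀ φ))
  ax2 : ∀ φ χ ψ → IntAx₀ ((φ ⇒₀ (χ ⇒₀ ψ)) ⇒₀ ((φ ⇒₀ χ) ⇒₀ (φ ⇒₀ ψ)))
  ax3 : ∀ φ ψ → IntAx₀ ((φ ∧₀ ψ) ⇒₀ φ)
  ax4 : ∀ φ ψ → IntAx₀ ((φ ∧₀ ψ) ⇒₀ ψ)
  ax5 : ∀ φ ψ → IntAx₀ (φ ⇒₀ (ψ ⇒₀ (φ ∧₀ ψ)))
  ax6 : ∀ φ ψ → IntAx₀ (φ ⇒₀ (φ ∨₀ ψ))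
  ax7 : ∀ φ ψ → IntAx₀ (ψ ⇒₀ (φ ∨₀ ψ))
  ax8 : ∀ φ ψ χ → IntAx₀ ((φ ⇒₀ ψ) ⇒₀ ((χ ⇒₀ ψ) ⇒₀ ((φ ∨₀ χ) ⇒₀ ψ)))
  ax9 : ∀ φ → IntAx₀ (⊥₀ ⇒₀ φ)

-- A set of L₀-formulas is represented by its membership predicate.
-- An intermediate logic: proper subset of L₀ containing the axiom
-- instances, closed under modus ponens and substitution.
record IntermediateLogic (L : Form₀ → Set) : Set where
  field
    axioms : ∀ φ → IntAx₀ φ → L φ
    mp     : ∀ φ ψ → L φ → L (φ ⇒₀ ψ) → L ψ
    substC : ∀ σ φ → L φ → L (subst₀ σ φ)
    proper : ∃ λ φ → ¬ L φ

-- ⋀ of a finite list (empty conjunction = ⊥ → ⊥, i.e. ⊤)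
⋀₀ : List Form₀ → Form₀
⋀₀ []       = ⊥₀ ⇒₀ ⊥₀
⋀₀ (γ ∷ γs) = γ ∧₀ ⋀₀ γs

_⊢[_]₀_ : (Form₀ → Set) → (Form₀ → Set) → Form₀ → Set
Γ ⊢[ L ]₀ φ = Σ (List Form₀) λ γs → All Γ γs × L (⋀₀ γs ⇒₀ φ)

module _ {c ℓ₁ ℓ₂ : Level} (A : HeytingAlgebra c ℓ₁ ℓ₂) where
  open HeytingAlgebra A

  IsHom₀ : (Form₀ → Carrier) → Set ℓ₁
  IsHom₀ f = (f ⊥₀ ≈ ⊥)
           × (∀ φ ψ → f (φ ∧₀ ψ) ≈ (f φ ∧ f ψ))
           × (∀ φ ψ → f (φ ∨₀ ψ) ≈ (f φ ∨ f ψ))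
           × (∀ φ ψ → f (φ ⇒₀ ψ) ≈ (f φ ⇨ f ψ))

StronglyComplete : {c ℓ₁ ℓ₂ ℓ : Level} →
  (Form₀ → Set) → (HeytingAlgebra c ℓ₁ ℓ₂ → Set ℓ) → Set (lsuc (c ⊔ ℓ₁ ⊔ ℓ₂) ⊔ ℓ)
StronglyComplete {c} {ℓ₁} {ℓ₂} L C =
  ∀ (Γ : Form₀ → Set) (φ : Form₀) →
    (Γ ⊢[ L ]₀ φ →
      ∀ (A : HeytingAlgebra c ℓ₁ ℓ₂) → C A → ∀ (f : Form₀ → HeytingAlgebra.Carrier A) →
        IsHom₀ A f → (∀ γ → Γ γ → HeytingAlgebra._≈_ A (f γ) (HeytingAlgebra.⊤ A)) →
        HeytingAlgebra._≈_ A (f φ) (HeytingAlgebra.⊤ A))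
    × ((∀ (A : HeytingAlgebra c ℓ₁ ℓ₂) → C A → ∀ (f : Form₀ → HeytingAlgebra.Carrier A) →
        IsHom₀ A f → (∀ γ → Γ γ → HeytingAlgebra._≈_ A (f γ) (HeytingAlgebra.⊤ A)) →
        HeytingAlgebra._≈_ A (f φ) (HeytingAlgebra.⊤ A)) →
      Γ ⊢[ L ]₀ φ)

data Term : Set where
  tvar  : ℕ → Term
  tcon  : ℕ → Term
  _⊕_   : Term → Term → Term
  _⊙_   : Term → Term → Term
  !_    : Term → Term

data FormJ : Set where
  ⊥J   : FormJ
  varJ : ℕ → FormJ
  _∧J_ : FormJ → FormJ → FormJ
  _∨J_ : FormJ → FormJ → FormJ
  _⇒J_ : FormJ → FormJ → FormJ
  _∶_  : Term → FormJ → FormJ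

infixr 7 _∧J_
infixr 6 _∨J_
infixr 5 _⇒J_
infixr 8 _∶_

substJ : (ℕ → FormJ) → Form₀ → FormJ
substJ σ ⊥₀       = ⊥J
substJ σ (var₀ i) = σ i
substJ σ (φ ∧₀ ψ) = substJ σ φ ∧J substJ σ ψ
substJ σ (φ ∨₀ ψ) = substJ σ φ ∨J substJ σ ψ
substJ σ (φ ⇒₀ ψ) = substJ σ φ ⇒J substJ σ ψ

data LBar (L : Form₀ → Set) : FormJ → Set where
  inst : ∀ (σ : ℕ → FormJ) ψ → L ψ → LBar L (substJ σ ψ)

data Variant : Set where
  vJ vJT vJ4 vJT4 : Variant

data HasF : Variant → Set where
  fJT  : HasF vJT
  fJT4 : HasF vJT4

data HasI : Variant → Set where
  iJ4  : HasI vJ4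
  iJT4 : HasI vJT4

data JAx (v : Variant) : FormJ → Set where
  axJ  : ∀ t s φ ψ → JAx v (t ∶ (φ ⇒J ψ) ⇒J (s ∶ φ ⇒J (t ⊙ s) ∶ ψ))
  axP1 : ∀ t s φ → JAx v (t ∶ φ ⇒J (t ⊕ s) ∶ φ)
  axP2 : ∀ t s φ → JAx v (t ∶ φ ⇒J (s ⊕ t) ∶ φ)
  axF  : HasF v → ∀ t φ → JAx v (t ∶ φ ⇒J φ)
  axI  : HasI v → ∀ t φ → JAx v (t ∶ φ ⇒J (! t) ∶ t ∶ φ)

data LJL₀ (v : Variant) (L : Form₀ → Set) : FormJ → Set where
  lbar : ∀ {φ} → LBar L φ → LJL₀ v L φ
  jax  : ∀ {φ} → JAx v φ → LJL₀ v L φ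
  mpJ  : ∀ {φ ψ} → LJL₀ v L φ → LJL₀ v L (φ ⇒J ψ) → LJL₀ v L ψ

data CSForm (v : Variant) (L : Form₀ → Set) : FormJ → Set where
  base-lbar : ∀ i {φ} → LBar L φ → CSForm v L (tcon i ∶ φ)
  base-jax  : ∀ i {φ} → JAx v φ → CSForm v L (tcon i ∶ φ)
  step      : ∀ i {χ} → CSForm v L χ → CSForm v L (tcon i ∶ χ)

IsCS : Variant → (Form₀ → Set) → (FormJ → Set) → Set
IsCS v L CS = ∀ χ → CS χ → CSForm v L χ

⋀J : List FormJ → FormJ
⋀J []       = ⊥J ⇒J ⊥J
⋀J (γ ∷ γs) = γ ∧J ⋀J γs

Derives : Variant → (Form₀ → Set) → (FormJ → Set) → (FormJ → Set) → FormJ → Set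
Derives v L CS Γ φ =
  Σ (List FormJ) λ γs → All (λ γ → Γ γ ⊎ CS γ) γs × LJL₀ v L (⋀J γs ⇒J φ)

record Mkrtychev {c ℓ₁ ℓ₂ : Level} (A : HeytingAlgebra c ℓ₁ ℓ₂) : Set (c ⊔ ℓ₁ ⊔ ℓ₂) where
  open HeytingAlgebra A
  field
    𝒱      : FormJ → Carrier
    hom-⊥  : 𝒱 ⊥J ≈ ⊥
    hom-∧  : ∀ φ ψ → 𝒱 (φ ∧J ψ) ≈ (𝒱 φ ∧ 𝒱 ψ)
    hom-∨  : ∀ φ ψ → 𝒱 (φ ∨J ψ) ≈ (𝒱 φ ∨ 𝒱 ψ)
    hom-⇒  : ∀ φ ψ → 𝒱 (φ ⇒J ψ) ≈ (𝒱 φ ⇨ 𝒱 ψ)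
    app    : ∀ t s φ ψ → (𝒱 (t ∶ (φ ⇒J ψ)) ∧ 𝒱 (s ∶ φ)) ≤ 𝒱 ((t ⊙ s) ∶ ψ)
    sum    : ∀ t s φ → (𝒱 (t ∶ φ) ∨ 𝒱 (s ∶ φ)) ≤ 𝒱 ((t ⊕ s) ∶ φ)

module _ {c ℓ₁ ℓ₂ : Level} {A : HeytingAlgebra c ℓ₁ ℓ₂} where
  open HeytingAlgebra A
  open Mkrtychev

  Factive : Mkrtychev A → Set ℓ₂
  Factive M = ∀ t φ → 𝒱 M (t ∶ φ) ≤ 𝒱 M φ

  Introspective : Mkrtychev A → Set ℓ₂
  Introspective M = ∀ t φ → 𝒱 M (t ∶ φ) ≤ 𝒱 M ((! t) ∶ t ∶ φ)

  RespectsCS : (FormJ → Set) → Mkrtychev A → Set ℓ₁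
  RespectsCS CS M = ∀ χ → CS χ → 𝒱 M χ ≈ ⊤

  FitsVariant : Variant → Mkrtychev A → Set ℓ₂
  FitsVariant v M = (HasF v → Factive M) × (HasI v → Introspective M)

  IsMeetOf : (FormJ → Set) → Mkrtychev A → Carrier → Set (c ⊔ ℓ₂)
  IsMeetOf Γ M m = (∀ γ → Γ γ → m ≤ 𝒱 M γ)
                 × (∀ x → (∀ γ → Γ γ → x ≤ 𝒱 M γ) → x ≤ m)

InCAMJL-CS : {c ℓ₁ ℓ₂ ℓ : Level} → (HeytingAlgebra c ℓ₁ ℓ₂ → Set ℓ) → Variant → (FormJ → Set) →
  (A : HeytingAlgebra c ℓ₁ ℓ₂) → Mkrtychev A → Set (ℓ ⊔ ℓ₁ ⊔ ℓ₂)
InCAMJL-CS C v CS A M = C A × FitsVariant v M × RespectsCS CS M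

Models : {c ℓ₁ ℓ₂ ℓ : Level} → (HeytingAlgebra c ℓ₁ ℓ₂ → Set ℓ) → Variant → (FormJ → Set) →
  (FormJ → Set) → FormJ → Set (lsuc (c ⊔ ℓ₁ ⊔ ℓ₂) ⊔ ℓ)
Models {c} {ℓ₁} {ℓ₂} C v CS Γ φ =
  ∀ (A : HeytingAlgebra c ℓ₁ ℓ₂) (M : Mkrtychev A) → InCAMJL-CS C v CS A M →
    ∀ m → IsMeetOf Γ M m → HeytingAlgebra._≤_ A m (Mkrtychev.𝒱 M φ)

Models¹ : {c ℓ₁ ℓ₂ ℓ : Level} → (HeytingAlgebra c ℓ₁ ℓ₂ → Set ℓ) → Variant → (FormJ → Set) →
  (FormJ → Set) → FormJ → Set (lsuc (c ⊔ ℓ₁ ⊔ ℓ₂) ⊔ ℓ)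
Models¹ {c} {ℓ₁} {ℓ₂} C v CS Γ φ =
  ∀ (A : HeytingAlgebra c ℓ₁ ℓ₂) (M : Mkrtychev A) → InCAMJL-CS C v CS A M →
    (∀ γ → Γ γ → HeytingAlgebra._≈_ A (Mkrtychev.𝒱 M γ) (HeytingAlgebra.⊤ A)) →
    HeytingAlgebra._≈_ A (Mkrtychev.𝒱 M φ) (HeytingAlgebra.⊤ A)

module Submission where

-- (1) ⇒ (2) is soundness: substitution instances of L-theorems are ⊤ in
-- every model over an algebra of C (by the soundness half of strong
-- completeness of L), the justification schemes are ⊤ exactly because of
-- the defining inequalities of the model class, and modus ponens preserves
-- ⊤.  (2) ⇒ (3) holds because ⊤ is the meet of 𝒱[Γ] when 𝒱[Γ] ⊆ {1}.
--
-- (3) ⇒ (1) reduces to strong completeness of L.  Number the formulas of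
-- L_J (Cantor pairing) and translate L_J into L₀ by reading every atom
-- (p_i or t:ψ) as the propositional variable carrying its code; the
-- substitution "decode" undoes the translation.  A homomorphism f : L₀ → A
-- that sends the translations of Γ, CS and all LJL₀-theorems to ⊤ induces
-- the Mkrtychev model f ∘ translate, which lies in CAMJL_CS because the
-- justification schemes are ⊤ in it.  Hence the translated set entails the
-- translation of φ in L; applying "decode" to that L-derivation and
-- discarding the theorem conjuncts yields an LJL_CS-derivation of φ.

open import Defs
open import Level using (Level)
open import Function using (_∘_)
open import Data.Nat using (ℕ; zero; suc; _+_; _⊔_; s≤s)
import Data.Nat as ℕ
open import Data.Nat.Properties
  using (+-suc; +-identityʳ; suc-injective; m⊔n≤o⇒m≤o; m⊔n≤o⇒n≤o; ≤-refl)
open import Data.List using (List; []; _∷_; map)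
open import Data.List.Relation.Unary.All as All using (All; []; _∷_)
open import Data.List.Relation.Unary.All.Properties using (map⁺)
open import Data.Product using (Σ; _×_; _,_; proj₁; proj₂)
open import Data.Sum using (_⊎_; inj₁; inj₂)
open import Data.Empty.Polymorphic using () renaming (⊥ to Empty)
open import Relation.Binary.PropositionalEquality
  using (_≡_; cong; cong₂; subst; subst₂; module ≡-Reasoning)
import Relation.Binary.PropositionalEquality as ≡
open import Relation.Binary.Lattice.Bundles using (HeytingAlgebra)
import Relation.Binary.Lattice.Properties.HeytingAlgebra as HeytingProperties

-- Cantor pairing: ℕ × ℕ → ℕ with a left inverse

triangle : ℕ → ℕ
triangle zero    = zero
triangle (suc d) = suc (triangle d + d)

-- the point (x , y) is number x on the diagonal x + y
pair : ℕ → ℕ → ℕ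
pair x y = triangle (x + y) + x

-- successor of a point in the diagonal-by-diagonal enumeration
next : ℕ × ℕ → ℕ × ℕ
next (x , suc y) = (suc x , y)
next (x , zero)  = (zero , suc x)

unpair : ℕ → ℕ × ℕ
unpair zero    = (zero , zero)
unpair (suc n) = next (unpair n)

-- pair is compatible with next: moving along a diagonal ...
pair-suc-left : ∀ x y → pair (suc x) y ≡ suc (pair x (suc y))
pair-suc-left x y = begin
  suc (triangle (x + y) + (x + y)) + suc x   ≡⟨ cong suc (+-suc _ x) ⟩
  suc (suc (triangle (x + y) + (x + y) + x)) ≡⟨ cong (λ d → suc (triangle d + x)) (+-suc x y) ⟨
  suc (triangle (x + suc y) + x)             ∎
  where open ≡-Reasoning

-- ... and jumping to the start of the next diagonal
pair-jump : ∀ y → pair zero (suc y) ≡ suc (pair y zero)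
pair-jump y = begin
  suc (triangle y + y) + 0 ≡⟨ +-identityʳ _ ⟩
  suc (triangle y + y)     ≡⟨ cong (λ d → suc (triangle d + y)) (+-identityʳ y) ⟨
  suc (triangle (y + 0) + y) ∎
  where open ≡-Reasoning

-- by induction along the enumeration (lexicographically on diagonal, position)
unpair-pair : ∀ x y → unpair (pair x y) ≡ (x , y)
unpair-pair x y = along (x + y) x y ≡.refl
  where
  along : ∀ d x y → x + y ≡ d → unpair (pair x y) ≡ (x , y)
  along d       (suc x) y       e =
    subst (λ n → unpair n ≡ (suc x , y)) (≡.sym (pair-suc-left x y))
      (cong next (along d x (suc y) (≡.trans (+-suc x y) e)))
  along (suc d) zero    (suc y) e =
    subst (λ n → unpair n ≡ (zero , suc y)) (≡.sym (pair-jump y))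
      (cong next (along d y zero (≡.trans (+-identityʳ y) (suc-injective e))))
  along _       zero    zero    _ = ≡.refl
  along zero    zero    (suc y) ()

-- A node is coded as pair tag (code of its children); decoding with a fuel
-- bound at least the depth of the tree recovers it.  The depth is stored
-- in the final code, so decode (code φ) ≡ φ.

codeT : Term → ℕ
codeT (tvar i) = pair 0 i
codeT (tcon i) = pair 1 i
codeT (t ⊕ s)  = pair 2 (pair (codeT t) (codeT s))
codeT (t ⊙ s)  = pair 3 (pair (codeT t) (codeT s))
codeT (! t)    = pair 4 (codeT t)

depthT : Term → ℕ
depthT (tvar i) = 1
depthT (tcon i) = 1
depthT (t ⊕ s)  = suc (depthT t ⊔ depthT s)
depthT (t ⊙ s)  = suc (depthT t ⊔ depthT s)
depthT (! t)    = suc (depthT t)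

decodeT : ℕ → ℕ → Term
decodeNodeT : ℕ → ℕ × ℕ → Term
decodeT zero    n = tvar 0
decodeT (suc k) n = decodeNodeT k (unpair n)
decodeNodeT k (0 , i) = tvar i
decodeNodeT k (1 , i) = tcon i
decodeNodeT k (2 , j) = decodeT k (proj₁ (unpair j)) ⊕ decodeT k (proj₂ (unpair j))
decodeNodeT k (3 , j) = decodeT k (proj₁ (unpair j)) ⊙ decodeT k (proj₂ (unpair j))
decodeNodeT k (4 , j) = ! decodeT k j
decodeNodeT k (_ , j) = tvar 0

decodeT-codeT : ∀ t k → depthT t ℕ.≤ k → decodeT k (codeT t) ≡ t
decodeT-codeT (tvar i) (suc k) _ rewrite unpair-pair 0 i = ≡.refl
decodeT-codeT (tcon i) (suc k) _ rewrite unpair-pair 1 i = ≡.refl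
decodeT-codeT (t ⊕ s) (suc k) (s≤s h)
  rewrite unpair-pair 2 (pair (codeT t) (codeT s)) | unpair-pair (codeT t) (codeT s) =
  cong₂ _⊕_ (decodeT-codeT t k (m⊔n≤o⇒m≤o _ _ h)) (decodeT-codeT s k (m⊔n≤o⇒n≤o _ _ h))
decodeT-codeT (t ⊙ s) (suc k) (s≤s h)
  rewrite unpair-pair 3 (pair (codeT t) (codeT s)) | unpair-pair (codeT t) (codeT s) =
  cong₂ _⊙_ (decodeT-codeT t k (m⊔n≤o⇒m≤o _ _ h)) (decodeT-codeT s k (m⊔n≤o⇒n≤o _ _ h))
decodeT-codeT (! t) (suc k) (s≤s h) rewrite unpair-pair 4 (codeT t) =
  cong !_ (decodeT-codeT t k h)

codeF : FormJ → ℕ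
codeF ⊥J       = pair 0 0
codeF (varJ i) = pair 1 i
codeF (φ ∧J ψ) = pair 2 (pair (codeF φ) (codeF ψ))
codeF (φ ∨J ψ) = pair 3 (pair (codeF φ) (codeF ψ))
codeF (φ ⇒J ψ) = pair 4 (pair (codeF φ) (codeF ψ))
codeF (t ∶ φ)  = pair 5 (pair (codeT t) (codeF φ))

depthF : FormJ → ℕ
depthF ⊥J       = 1
depthF (varJ i) = 1
depthF (φ ∧J ψ) = suc (depthF φ ⊔ depthF ψ)
depthF (φ ∨J ψ) = suc (depthF φ ⊔ depthF ψ)
depthF (φ ⇒J ψ) = suc (depthF φ ⊔ depthF ψ)
depthF (t ∶ φ)  = suc (depthT t ⊔ depthF φ)

decodeF : ℕ → ℕ → FormJ
decodeNodeF : ℕ → ℕ × ℕ → FormJ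
decodeF zero    n = ⊥J
decodeF (suc k) n = decodeNodeF k (unpair n)
decodeNodeF k (0 , i) = ⊥J
decodeNodeF k (1 , i) = varJ i
decodeNodeF k (2 , j) = decodeF k (proj₁ (unpair j)) ∧J decodeF k (proj₂ (unpair j))
decodeNodeF k (3 , j) = decodeF k (proj₁ (unpair j)) ∨J decodeF k (proj₂ (unpair j))
decodeNodeF k (4 , j) = decodeF k (proj₁ (unpair j)) ⇒J decodeF k (proj₂ (unpair j))
decodeNodeF k (5 , j) = decodeT k (proj₁ (unpair j)) ∶ decodeF k (proj₂ (unpair j))
decodeNodeF k (_ , j) = ⊥J

decodeF-codeF : ∀ φ k → depthF φ ℕ.≤ k → decodeF k (codeF φ) ≡ φ
decodeF-codeF ⊥J       (suc k) _ rewrite unpair-pair 0 0 = ≡.refl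
decodeF-codeF (varJ i) (suc k) _ rewrite unpair-pair 1 i = ≡.refl
decodeF-codeF (φ ∧J ψ) (suc k) (s≤s h)
  rewrite unpair-pair 2 (pair (codeF φ) (codeF ψ)) | unpair-pair (codeF φ) (codeF ψ) =
  cong₂ _∧J_ (decodeF-codeF φ k (m⊔n≤o⇒m≤o _ _ h)) (decodeF-codeF ψ k (m⊔n≤o⇒n≤o _ _ h))
decodeF-codeF (φ ∨J ψ) (suc k) (s≤s h)
  rewrite unpair-pair 3 (pair (codeF φ) (codeF ψ)) | unpair-pair (codeF φ) (codeF ψ) =
  cong₂ _∨J_ (decodeF-codeF φ k (m⊔n≤o⇒m≤o _ _ h)) (decodeF-codeF ψ k (m⊔n≤o⇒n≤o _ _ h))
decodeF-codeF (φ ⇒J ψ) (suc k) (s≤s h)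
  rewrite unpair-pair 4 (pair (codeF φ) (codeF ψ)) | unpair-pair (codeF φ) (codeF ψ) =
  cong₂ _⇒J_ (decodeF-codeF φ k (m⊔n≤o⇒m≤o _ _ h)) (decodeF-codeF ψ k (m⊔n≤o⇒n≤o _ _ h))
decodeF-codeF (t ∶ φ) (suc k) (s≤s h)
  rewrite unpair-pair 5 (pair (codeT t) (codeF φ)) | unpair-pair (codeT t) (codeF φ) =
  cong₂ _∶_ (decodeT-codeT t k (m⊔n≤o⇒m≤o _ _ h)) (decodeF-codeF φ k (m⊔n≤o⇒n≤o _ _ h))

-- the code of φ together with a sufficient fuel bound
code : FormJ → ℕ
code φ = pair (depthF φ) (codeF φ)

decode : ℕ → FormJ
decode n = decodeF (proj₁ (unpair n)) (proj₂ (unpair n))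

decode-code : ∀ φ → decode (code φ) ≡ φ
decode-code φ rewrite unpair-pair (depthF φ) (codeF φ) = decodeF-codeF φ (depthF φ) ≤-refl

-- atoms p_i and t:ψ become propositional variables named by their code
translate : FormJ → Form₀
translate ⊥J       = ⊥₀
translate (varJ i) = var₀ (code (varJ i))
translate (φ ∧J ψ) = translate φ ∧₀ translate ψ
translate (φ ∨J ψ) = translate φ ∨₀ translate ψ
translate (φ ⇒J ψ) = translate φ ⇒₀ translate ψ
translate (t ∶ φ)  = var₀ (code (t ∶ φ))

decode-translate : ∀ φ → substJ decode (translate φ) ≡ φ
decode-translate ⊥J       = ≡.refl
decode-translate (varJ i) = decode-code (varJ i)
decode-translate (φ ∧J ψ) = cong₂ _∧J_ (decode-translate φ) (decode-translate ψ)
decode-translate (φ ∨J ψ) = cong₂ _∨J_ (decode-translate φ) (decode-translate ψ)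
decode-translate (φ ⇒J ψ) = cong₂ _⇒J_ (decode-translate φ) (decode-translate ψ)
decode-translate (t ∶ φ)  = decode-code (t ∶ φ)

substJ-⋀ : ∀ σ γs → substJ σ (⋀₀ γs) ≡ ⋀J (map (substJ σ) γs)
substJ-⋀ σ []       = ≡.refl
substJ-⋀ σ (γ ∷ γs) = cong (substJ σ γ ∧J_) (substJ-⋀ σ γs)

module Validity {c ℓ₁ ℓ₂ : Level} (A : HeytingAlgebra c ℓ₁ ℓ₂) where
  open HeytingAlgebra A
  open HeytingProperties A using (⇨-eval)

  ≤⇒⇨≈⊤ : ∀ {x y} → x ≤ y → (x ⇨ y) ≈ ⊤
  ≤⇒⇨≈⊤ x≤y = antisym (maximum _) (transpose-⇨ (trans (x∧y≤y _ _) x≤y))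

  ⇨≈⊤⇒≤ : ∀ {x y} → (x ⇨ y) ≈ ⊤ → x ≤ y
  ⇨≈⊤⇒≤ e = trans (∧-greatest (trans (maximum _) (reflexive (Eq.sym e))) refl) ⇨-eval

  module _ (g : FormJ → Carrier) (g-⇒ : ∀ φ ψ → g (φ ⇒J ψ) ≈ (g φ ⇨ g ψ)) where

    ⇒-valid : ∀ {φ ψ} → g φ ≤ g ψ → g (φ ⇒J ψ) ≈ ⊤
    ⇒-valid {φ} {ψ} h = Eq.trans (g-⇒ φ ψ) (≤⇒⇨≈⊤ h)

    valid-⇒ : ∀ {φ ψ} → g (φ ⇒J ψ) ≈ ⊤ → g φ ≤ g ψ
    valid-⇒ {φ} {ψ} e = ⇨≈⊤⇒≤ (Eq.trans (Eq.sym (g-⇒ φ ψ)) e)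

    ⇒⇒-valid : ∀ {φ ψ χ} → (g φ ∧ g ψ) ≤ g χ → g (φ ⇒J ψ ⇒J χ) ≈ ⊤
    ⇒⇒-valid {φ} {ψ} {χ} h = ⇒-valid (trans (transpose-⇨ h) (reflexive (Eq.sym (g-⇒ ψ χ))))

    valid-⇒⇒ : ∀ {φ ψ χ} → g (φ ⇒J ψ ⇒J χ) ≈ ⊤ → (g φ ∧ g ψ) ≤ g χ
    valid-⇒⇒ {φ} {ψ} {χ} e = transpose-∧ (trans (valid-⇒ e) (reflexive (g-⇒ ψ χ)))

module Hilbert (L : Form₀ → Set) (IL : IntermediateLogic L) (v : Variant) where
  open IntermediateLogic IL using (axioms)

  ⊢_ : FormJ → Set
  ⊢ φ = LJL₀ v L φ

  [_,_,_] : FormJ → FormJ → FormJ → ℕ → FormJ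
  [ a , b , d ] 0 = a
  [ a , b , d ] 1 = b
  [ a , b , d ] _ = d

  intuitionistic : ∀ {ψ} → IntAx₀ ψ → (σ : ℕ → FormJ) → ⊢ substJ σ ψ
  intuitionistic {ψ} ax σ = lbar (inst σ ψ (axioms ψ ax))

  p₀ p₁ p₂ : Form₀
  p₀ = var₀ 0
  p₁ = var₀ 1
  p₂ = var₀ 2

  weaken : ∀ {a b} → ⊢ b → ⊢ (a ⇒J b)
  weaken {a} {b} ⊢b = mpJ ⊢b (intuitionistic (ax1 p₀ p₁) [ b , a , b ])

  ⇒-trans : ∀ {a b d} → ⊢ (a ⇒J b) → ⊢ (b ⇒J d) → ⊢ (a ⇒J d)
  ⇒-trans {a} {b} {d} ab bd = mpJ ab (mpJ (weaken bd) (intuitionistic (ax2 p₀ p₁ p₂) [ a , b , d ]))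

  ⇒-refl : ∀ a → ⊢ (a ⇒J a)
  ⇒-refl a = mpJ (intuitionistic (ax1 p₀ p₁) [ a , a , a ])
               (mpJ (intuitionistic (ax1 p₀ p₁) [ a , a ⇒J a , a ])
                    (intuitionistic (ax2 p₀ p₁ p₂) [ a , a ⇒J a , a ]))

  ∧-elimˡ : ∀ a b → ⊢ (a ∧J b ⇒J a)
  ∧-elimˡ a b = intuitionistic (ax3 p₀ p₁) [ a , b , a ]

  ∧-elimʳ : ∀ a b → ⊢ (a ∧J b ⇒J b)
  ∧-elimʳ a b = intuitionistic (ax4 p₀ p₁) [ a , b , a ]

  ⇒-∧ : ∀ {a b d} → ⊢ (a ⇒J b) → ⊢ (a ⇒J d) → ⊢ (a ⇒J b ∧J d)
  ⇒-∧ {a} {b} {d} ab ad =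
    mpJ ad (mpJ (⇒-trans ab (intuitionistic (ax5 p₀ p₁) [ b , d , b ]))
                (intuitionistic (ax2 p₀ p₁ p₂) [ a , d , b ∧J d ]))

  discharge-theorems : (H : FormJ → Set) (χs : List FormJ) → All (λ χ → H χ ⊎ ⊢ χ) χs →
    Σ (List FormJ) λ ηs → All H ηs × ⊢ (⋀J ηs ⇒J ⋀J χs)
  discharge-theorems H []       []              = [] , [] , ⇒-refl _
  discharge-theorems H (χ ∷ χs) (inj₁ hχ ∷ hχs) =
    let ηs , hηs , ⊢ηs⇒χs = discharge-theorems H χs hχs
    in  χ ∷ ηs , hχ ∷ hηs , ⇒-∧ (∧-elimˡ _ _) (⇒-trans (∧-elimʳ _ _) ⊢ηs⇒χs)
  discharge-theorems H (χ ∷ χs) (inj₂ ⊢χ ∷ hχs) =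
    let ηs , hηs , ⊢ηs⇒χs = discharge-theorems H χs hχs
    in  ηs , hηs , ⇒-∧ (weaken ⊢χ) ⊢ηs⇒χs

module _ {c ℓ₁ ℓ₂ ℓ : Level} (L : Form₀ → Set) (IL : IntermediateLogic L)
         (C : HeytingAlgebra c ℓ₁ ℓ₂ → Set ℓ) (SC : StronglyComplete L C) where

  L-theorem-valid : ∀ {ψ} → L ψ → (A : HeytingAlgebra c ℓ₁ ℓ₂) → C A →
    (f : Form₀ → HeytingAlgebra.Carrier A) → IsHom₀ A f →
    HeytingAlgebra._≈_ A (f ψ) (HeytingAlgebra.⊤ A)
  L-theorem-valid {ψ} Lψ A CA f f-hom =
    proj₁ (SC (λ _ → Empty) ψ) ([] , [] , ⊤⇒ψ) A CA f f-hom (λ _ ())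
    where
    open IntermediateLogic IL
    ⊤⇒ψ : L (⋀₀ [] ⇒₀ ψ)
    ⊤⇒ψ = mp ψ _ Lψ (axioms _ (ax1 ψ (⋀₀ [])))

  module _ {A : HeytingAlgebra c ℓ₁ ℓ₂} (CA : C A) (M : Mkrtychev A) where
    open HeytingAlgebra A
    open Mkrtychev M
    open Validity A

    -- 𝒱 ∘ substJ σ is a homomorphism on L₀, so instances of L-theorems are ⊤
    substitution-hom : (σ : ℕ → FormJ) → IsHom₀ A (𝒱 ∘ substJ σ)
    substitution-hom σ = hom-⊥ , (λ _ _ → hom-∧ _ _) , (λ _ _ → hom-∨ _ _) , (λ _ _ → hom-⇒ _ _)

    -- the justification schemes express the defining inequalities of the model
    scheme-valid : ∀ {v θ} → FitsVariant v M → JAx v θ → 𝒱 θ ≈ ⊤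
    scheme-valid _              (axJ t s φ ψ) = ⇒⇒-valid 𝒱 hom-⇒ (app t s φ ψ)
    scheme-valid _              (axP1 t s φ)  = ⇒-valid 𝒱 hom-⇒ (trans (x≤x∨y _ _) (sum t s φ))
    scheme-valid _              (axP2 t s φ)  = ⇒-valid 𝒱 hom-⇒ (trans (y≤x∨y _ _) (sum s t φ))
    scheme-valid (factive , _)  (axF f t φ)   = ⇒-valid 𝒱 hom-⇒ (factive f t φ)
    scheme-valid (_ , introsp)  (axI i t φ)   = ⇒-valid 𝒱 hom-⇒ (introsp i t φ)

    theorem-valid : ∀ {v θ} → FitsVariant v M → LJL₀ v L θ → 𝒱 θ ≈ ⊤
    theorem-valid fits (lbar (inst σ ψ Lψ)) =
      L-theorem-valid Lψ A CA (𝒱 ∘ substJ σ) (substitution-hom σ)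
    theorem-valid fits (jax ax)             = scheme-valid fits ax
    theorem-valid fits (mpJ ⊢φ ⊢φ⇒ψ)        =
      antisym (maximum _)
        (trans (reflexive (Eq.sym (theorem-valid fits ⊢φ))) (valid-⇒ 𝒱 hom-⇒ (theorem-valid fits ⊢φ⇒ψ)))

    below-⋀ : ∀ {m} γs → All (λ γ → m ≤ 𝒱 γ) γs → m ≤ 𝒱 (⋀J γs)
    below-⋀ []       []         = trans (maximum _) (reflexive (Eq.sym (⇒-valid 𝒱 hom-⇒ refl)))
    below-⋀ (γ ∷ γs) (m≤γ ∷ m≤γs) = trans (∧-greatest m≤γ (below-⋀ γs m≤γs)) (reflexive (Eq.sym (hom-∧ _ _)))

  -- (1) ⇒ (2): the meet of 𝒱[Γ] lies below 𝒱 of each used assumption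
  -- (CS members being ⊤), hence below 𝒱(⋀γs) ≤ 𝒱(φ)
  soundness : ∀ v CS Γ φ → Derives v L CS Γ φ → Models C v CS Γ φ
  soundness v CS Γ φ (γs , hyps , ⊢⋀γs⇒φ) A M (CA , fits , respects) m (m≤Γ , _) =
    trans (below-⋀ CA M γs (All.map m≤hyp hyps)) (valid-⇒ 𝒱 hom-⇒ (theorem-valid CA M fits ⊢⋀γs⇒φ))
    where
    open HeytingAlgebra A
    open Mkrtychev M
    open Validity A
    m≤hyp : ∀ {γ} → Γ γ ⊎ CS γ → m ≤ 𝒱 γ
    m≤hyp (inj₁ γ∈Γ)  = m≤Γ _ γ∈Γ
    m≤hyp (inj₂ γ∈CS) = trans (maximum m) (reflexive (Eq.sym (respects _ γ∈CS)))

-- (2) ⇒ (3): when 𝒱[Γ] ⊆ {1}, the meet of 𝒱[Γ] exists and is ⊤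
meet-entails-top : ∀ {c ℓ₁ ℓ₂ ℓ} (C : HeytingAlgebra c ℓ₁ ℓ₂ → Set ℓ) v CS Γ φ →
  Models C v CS Γ φ → Models¹ C v CS Γ φ
meet-entails-top C v CS Γ φ models A M inClass Γ≈⊤ =
  antisym (maximum _) (models A M inClass ⊤ ((λ γ γ∈Γ → reflexive (Eq.sym (Γ≈⊤ γ γ∈Γ))) , λ x _ → maximum x))
  where open HeytingAlgebra A

module _ {c ℓ₁ ℓ₂ : Level} (A : HeytingAlgebra c ℓ₁ ℓ₂) (v : Variant)
         (f : Form₀ → HeytingAlgebra.Carrier A) (f-hom : IsHom₀ A f)
         (schemes : ∀ θ → JAx v θ → HeytingAlgebra._≈_ A (f (translate θ)) (HeytingAlgebra.⊤ A)) where
  open HeytingAlgebra A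
  open Validity A

  private
    f-⊥ = proj₁ f-hom
    f-∧ = proj₁ (proj₂ f-hom)
    f-∨ = proj₁ (proj₂ (proj₂ f-hom))
    f-⇒ = proj₂ (proj₂ (proj₂ f-hom))

    g : FormJ → Carrier
    g = f ∘ translate

    g-⇒ : ∀ φ ψ → g (φ ⇒J ψ) ≈ (g φ ⇨ g ψ)
    g-⇒ φ ψ = f-⇒ (translate φ) (translate ψ)

    scheme-≤ : ∀ φ ψ → JAx v (φ ⇒J ψ) → g φ ≤ g ψ
    scheme-≤ φ ψ ax = valid-⇒ g g-⇒ {φ} {ψ} (schemes _ ax)

  inducedModel : Mkrtychev A
  inducedModel = record
    { 𝒱     = g
    ; hom-⊥ = f-⊥
    ; hom-∧ = λ φ ψ → f-∧ (translate φ) (translate ψ)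
    ; hom-∨ = λ φ ψ → f-∨ (translate φ) (translate ψ)
    ; hom-⇒ = g-⇒
    ; app   = λ t s φ ψ → valid-⇒⇒ g g-⇒ {t ∶ (φ ⇒J ψ)} {s ∶ φ} {(t ⊙ s) ∶ ψ} (schemes _ (axJ t s φ ψ))
    ; sum   = λ t s φ → ∨-least (scheme-≤ (t ∶ φ) ((t ⊕ s) ∶ φ) (axP1 t s φ))
                                (scheme-≤ (s ∶ φ) ((t ⊕ s) ∶ φ) (axP2 s t φ))
    }

  inducedModel-fits : FitsVariant v inducedModel
  inducedModel-fits = (λ F t φ → scheme-≤ (t ∶ φ) φ (axF F t φ))
                    , (λ I t φ → scheme-≤ (t ∶ φ) ((! t) ∶ t ∶ φ) (axI I t φ))

module _ {c ℓ₁ ℓ₂ ℓ : Level} (L : Form₀ → Set) (IL : IntermediateLogic L) (v : Variant)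
         (CS : FormJ → Set) (C : HeytingAlgebra c ℓ₁ ℓ₂ → Set ℓ) (SC : StronglyComplete L C)
         (Γ : FormJ → Set) (φ : FormJ) where
  open Hilbert L IL v

  Γ⁺ : FormJ → Set
  Γ⁺ χ = (Γ χ ⊎ CS χ) ⊎ ⊢ χ

  Γ⁺₀ : Form₀ → Set
  Γ⁺₀ ψ = Γ⁺ (substJ decode ψ)

  translate-Γ⁺ : ∀ {χ} → Γ⁺ χ → Γ⁺₀ (translate χ)
  translate-Γ⁺ {χ} = subst Γ⁺ (≡.sym (decode-translate χ))

  -- semantic step: every homomorphism validating Γ⁺₀ induces a model of
  -- CAMJL_CS validating Γ, which by (3) validates φ
  Γ⁺₀-entails : Models¹ C v CS Γ φ → Γ⁺₀ ⊢[ L ]₀ translate φ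
  Γ⁺₀-entails models = proj₂ (SC Γ⁺₀ (translate φ)) semantic
    where
    semantic : ∀ (A : HeytingAlgebra c ℓ₁ ℓ₂) → C A → ∀ (f : Form₀ → HeytingAlgebra.Carrier A) →
      IsHom₀ A f → (∀ ψ → Γ⁺₀ ψ → HeytingAlgebra._≈_ A (f ψ) (HeytingAlgebra.⊤ A)) →
      HeytingAlgebra._≈_ A (f (translate φ)) (HeytingAlgebra.⊤ A)
    semantic A CA f f-hom Γ⁺₀≈⊤ =
      models A (inducedModel A v f f-hom schemes)
        (CA , inducedModel-fits A v f f-hom schemes , λ χ χ∈CS → valid (inj₁ (inj₂ χ∈CS)))
        (λ γ γ∈Γ → valid (inj₁ (inj₁ γ∈Γ)))
      where
      open HeytingAlgebra A using (_≈_; ⊤)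
      valid : ∀ {χ} → Γ⁺ χ → f (translate χ) ≈ ⊤
      valid h = Γ⁺₀≈⊤ _ (translate-Γ⁺ h)
      schemes : ∀ θ → JAx v θ → f (translate θ) ≈ ⊤
      schemes θ ax = valid (inj₂ (jax ax))

  -- syntactic step: decode the L-derivation and discharge the theorems
  completeness : Models¹ C v CS Γ φ → Derives v L CS Γ φ
  completeness models =
    let γs , γs∈Γ⁺₀ , ⊢L = Γ⁺₀-entails models
        ηs , ηs∈Γ∪CS , ⊢ηs⇒γs = discharge-theorems _ (map (substJ decode) γs) (map⁺ γs∈Γ⁺₀)
    in  ηs , ηs∈Γ∪CS , ⇒-trans ⊢ηs⇒γs (decoded ⊢L)
    where
    decoded : ∀ {γs} → L (⋀₀ γs ⇒₀ translate φ) → ⊢ (⋀J (map (substJ decode) γs) ⇒J φ)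
    decoded {γs} ⊢L = subst₂ (λ a b → ⊢ (a ⇒J b)) (substJ-⋀ decode γs) (decode-translate φ)
                        (lbar (inst decode _ ⊢L))

mainTheorem3 : {c ℓ₁ ℓ₂ ℓ : Level}
    (L : Form₀ → Set) → IntermediateLogic L →
    (v : Variant) (CS : FormJ → Set) → IsCS v L CS →
    (C : HeytingAlgebra c ℓ₁ ℓ₂ → Set ℓ) → StronglyComplete L C →
    (Γ : FormJ → Set) (φ : FormJ) →
    (Derives v L CS Γ φ → Models C v CS Γ φ)
    × (Models C v CS Γ φ → Models¹ C v CS Γ φ)
    × (Models¹ C v CS Γ φ → Derives v L CS Γ φ)
mainTheorem3 L IL v CS _ C SC Γ φ =
    soundness L IL C SC v CS Γ φ
  , meet-entails-top C v CS Γ φ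
  , completeness L IL v CS C SC Γ φ
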